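{- Let $k,M,N$ be positive integers with $N\ge2$, let $s_{ -M},\dots,s_{ -1},s_2,\dots,s_N$ be integers $\ge2k$ with $s_{ -1}\ne s_2$, and put $s_1=2k-1$. Then the word $$w=22\,1^{s_{ -M}}\,22\cdots22\,1^{s_{ -1}}\,22\,1^{2k-1}\,22\,1^{s_2}\,22\cdots22\,1^{s_N}$$ is not semisymmetric.
   Context: A finite word is semisymmetric if it is a palindrome or a concatenation of two palindromes; equivalently, the bi-infinite periodic sequences $\overline w$ and $\overline{w^T}$ lie in the same shift orbit, where $w^T$ is $w$ written backwards. $1^s$ denotes $s$ consecutive 1's. -}

module Defs where

open import Data.Nat using (ℕ; _∸_; _*_)
open import Data.List using (List; []; _∷_; _++_; reverse; replicate; concatMap)
open import Data.Product using (∃-syntax; _×_)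
open import Relation.Binary.PropositionalEquality using (_≡_)

Word : Set
Word = List ℕ

_ᵀ : Word → Word
w ᵀ = reverse w

IsPalindrome : Word → Set
IsPalindrome w = w ᵀ ≡ w

-- palindrome or concatenation of two palindromes
-- (taking u or v empty covers the palindrome case, since [] is a palindrome)
IsSemisymmetric : Word → Set
IsSemisymmetric w = ∃[ u ] ∃[ v ] (w ≡ u ++ v × IsPalindrome u × IsPalindrome v)

ones : ℕ → Word
ones s = replicate s 1

block : ℕ → Word
block s = 2 ∷ 2 ∷ ones s

wordOf : List ℕ → Word
wordOf es = concatMap block es

-- Since every exponent is positive, the word starts with 2 and ends with 1, so it is not a
-- palindrome, and in a factorisation w = u v into palindromes u must end in 2 and v start
-- with 1. Hence the cut lies just before a run of 1's, and u, v can only be palindromes when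
-- the exponent sequences on either side are; so the exponent sequence s_{-M} … s_N is itself
-- semisymmetric. In it, s_1 = 2k-1 occurs exactly once, and a palindrome containing a unique
-- letter is centred on it; the palindromic factor through s_1 then forces s_{-1} = s_2.
module Submission where

open import Defs
open import Data.Nat using (ℕ; zero; suc; _≤_; _<_; _*_; _∸_; NonZero; z<s; >-nonZero⁻¹)
open import Data.Nat.Properties using (<⇒≢; <⇒≤; <-trans; <-≤-trans; ∸-monoʳ-<; m<n⇒0<n∸m; *-monoʳ-≤)
open import Data.List using (List; []; _∷_; _++_; _∷ʳ_; reverse; replicate; head)
open import Data.List.Properties using (++-assoc; ++-identityʳ; ++-cancelʳ; reverse-++; unfold-reverse; reverse-involutive; ∷-injective; ∷-injectiveˡ; ∷-injectiveʳ; ∷ʳ-injectiveʳ; concatMap-++)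
open import Data.List.Relation.Unary.All as All using (All; []; _∷_)
open import Data.List.Relation.Unary.All.Properties using (++⁺; All¬⇒¬Any)
open import Data.List.Relation.Unary.Any using (here; there)
open import Data.List.Relation.Unary.Any.Properties using (reverse⁻)
open import Data.List.Membership.Propositional using (_∉_)
open import Data.List.Membership.Propositional.Properties using (∈-++⁺ˡ; ∈-++⁺ʳ)
open import Data.Maybe using (just)
open import Data.Product using (∃-syntax; _×_; _,_; proj₂)
open import Data.Sum using (_⊎_; inj₁; inj₂)
open import Data.Empty using (⊥-elim)
open import Function using (_∘_)
open import Relation.Nullary using (¬_)
open import Relation.Binary.PropositionalEquality using (_≡_; _≢_; refl; sym; trans; cong; cong₂; subst; module ≡-Reasoning)

open ≡-Reasoning

module _ {A : Set} where

  replicate-∷ʳ : ∀ n (x : A) → replicate (suc n) x ≡ replicate n x ∷ʳ x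
  replicate-∷ʳ zero    x = refl
  replicate-∷ʳ (suc n) x = cong (x ∷_) (replicate-∷ʳ n x)

  reverse-replicate : ∀ n (x : A) → reverse (replicate n x) ≡ replicate n x
  reverse-replicate zero    x = refl
  reverse-replicate (suc n) x = begin
    reverse (x ∷ replicate n x)   ≡⟨ unfold-reverse x (replicate n x) ⟩
    reverse (replicate n x) ∷ʳ x  ≡⟨ cong (_∷ʳ x) (reverse-replicate n x) ⟩
    replicate n x ∷ʳ x            ≡⟨ sym (replicate-∷ʳ n x) ⟩
    replicate (suc n) x           ∎

  replicate-++-cancel : ∀ m n {x : A} {xs ys} → head xs ≢ just x → head ys ≢ just x
    → replicate m x ++ xs ≡ replicate n x ++ ys → m ≡ n × xs ≡ ys
  replicate-++-cancel zero    zero    _  _  eq = refl , eq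
  replicate-++-cancel zero    (suc n) hx _  eq = ⊥-elim (hx (cong head eq))
  replicate-++-cancel (suc m) zero    _  hy eq = ⊥-elim (hy (cong head (sym eq)))
  replicate-++-cancel (suc m) (suc n) hx hy eq
    with m≡n , xs≡ys ← replicate-++-cancel m n hx hy (∷-injectiveʳ eq) = cong suc m≡n , xs≡ys

  replicate-++-prefix : ∀ n {x y : A} {xs ys zs} → x ≢ y
    → replicate n x ++ xs ≡ ys ++ y ∷ zs → ∃[ ws ] (ys ≡ replicate n x ++ ws × xs ≡ ws ++ y ∷ zs)
  replicate-++-prefix zero    {ys = ys}     _   eq = ys , refl , eq
  replicate-++-prefix (suc n) {ys = []}     x≢y eq = ⊥-elim (x≢y (∷-injectiveˡ eq))
  replicate-++-prefix (suc n) {ys = _ ∷ ys} x≢y eq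
    with refl , eq′ ← ∷-injective eq
    with ws , refl , xs≡ ← replicate-++-prefix n x≢y eq′ = ws , refl , xs≡

  palindrome-∷ʳ : ∀ {x : A} xs → reverse (x ∷ xs) ≡ x ∷ xs → ∃[ ys ] x ∷ xs ≡ ys ∷ʳ x
  palindrome-∷ʳ {x} xs pal = reverse xs , trans (sym pal) (unfold-reverse x xs)

  palindrome-head≡last : ∀ {x y : A} xs ys → reverse (x ∷ xs) ≡ x ∷ xs → x ∷ xs ≡ ys ∷ʳ y → x ≡ y
  palindrome-head≡last xs ys pal eq with zs , eq′ ← palindrome-∷ʳ xs pal =
    ∷ʳ-injectiveʳ zs ys (trans (sym eq′) eq)

  ∷ʳ-suffix : ∀ xs {y z : A} ys zs → xs ++ y ∷ ys ≡ zs ∷ʳ z → ∃[ ws ] y ∷ ys ≡ ws ∷ʳ z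
  ∷ʳ-suffix []           ys zs       eq = zs , eq
  ∷ʳ-suffix (_ ∷ xs)     ys (_ ∷ zs) eq = ∷ʳ-suffix xs ys zs (∷-injectiveʳ eq)
  ∷ʳ-suffix (_ ∷ [])     ys []       ()
  ∷ʳ-suffix (_ ∷ _ ∷ _)  ys []       ()

  palindrome-wrap : ∀ xs {w : List A} → reverse w ≡ w
    → reverse (xs ++ w ++ reverse xs) ≡ xs ++ w ++ reverse xs
  palindrome-wrap xs {w} pal = begin
    reverse (xs ++ w ++ reverse xs)                ≡⟨ reverse-++ xs (w ++ reverse xs) ⟩
    reverse (w ++ reverse xs) ++ reverse xs        ≡⟨ cong (_++ reverse xs) (reverse-++ w (reverse xs)) ⟩
    (reverse (reverse xs) ++ reverse w) ++ reverse xs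
      ≡⟨ cong (λ t → (t ++ reverse w) ++ reverse xs) (reverse-involutive xs) ⟩
    (xs ++ reverse w) ++ reverse xs                ≡⟨ cong (λ t → (xs ++ t) ++ reverse xs) pal ⟩
    (xs ++ w) ++ reverse xs                        ≡⟨ ++-assoc xs w (reverse xs) ⟩
    xs ++ w ++ reverse xs                          ∎

  ++-∷-unique : ∀ {c : A} xs ys xs′ ys′ → c ∉ xs → c ∉ xs′
    → xs ++ c ∷ ys ≡ xs′ ++ c ∷ ys′ → xs ≡ xs′ × ys ≡ ys′
  ++-∷-unique []       _ []        _ _    _     eq = refl , ∷-injectiveʳ eq
  ++-∷-unique []       _ (_ ∷ _)   _ _    c∉xs′ eq = ⊥-elim (c∉xs′ (here (∷-injectiveˡ eq)))
  ++-∷-unique (_ ∷ _)  _ []        _ c∉xs _     eq = ⊥-elim (c∉xs (here (sym (∷-injectiveˡ eq))))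
  ++-∷-unique (_ ∷ xs) ys (_ ∷ xs′) ys′ c∉xs c∉xs′ eq
    with refl , eq′ ← ∷-injective eq
    with refl , ys≡ys′ ← ++-∷-unique xs ys xs′ ys′ (c∉xs ∘ there) (c∉xs′ ∘ there) eq′ = refl , ys≡ys′

  palindrome-centre : ∀ {c : A} xs ys → c ∉ xs → c ∉ ys
    → reverse (xs ++ c ∷ ys) ≡ xs ++ c ∷ ys → ys ≡ reverse xs
  palindrome-centre {c} xs ys c∉xs c∉ys pal =
    sym (proj₂ (++-∷-unique (reverse ys) (reverse xs) xs ys (c∉ys ∘ reverse⁻) c∉xs (begin
      reverse ys ++ c ∷ reverse xs      ≡⟨ sym (++-assoc (reverse ys) (c ∷ []) (reverse xs)) ⟩
      (reverse ys ∷ʳ c) ++ reverse xs   ≡⟨ cong (_++ reverse xs) (sym (unfold-reverse c ys)) ⟩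
      reverse (c ∷ ys) ++ reverse xs    ≡⟨ sym (reverse-++ xs (c ∷ ys)) ⟩
      reverse (xs ++ c ∷ ys)            ≡⟨ pal ⟩
      xs ++ c ∷ ys                      ∎)))

  ++-∷-≡-++ : ∀ xs {c : A} ys P S → xs ++ c ∷ ys ≡ P ++ S
    → (∃[ B ] (P ≡ xs ++ c ∷ B × ys ≡ B ++ S)) ⊎ (∃[ C ] (xs ≡ P ++ C × S ≡ C ++ c ∷ ys))
  ++-∷-≡-++ []       ys []      S eq = inj₂ ([] , refl , sym eq)
  ++-∷-≡-++ []       ys (_ ∷ P) S eq with refl , eq′ ← ∷-injective eq = inj₁ (P , refl , eq′)
  ++-∷-≡-++ (x ∷ xs) ys []      S eq = inj₂ (x ∷ xs , refl , sym eq)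
  ++-∷-≡-++ (_ ∷ xs) ys (_ ∷ P) S eq with refl , eq′ ← ∷-injective eq with ++-∷-≡-++ xs ys P S eq′
  ... | inj₁ (B , refl , ys≡) = inj₁ (B , refl , ys≡)
  ... | inj₂ (C , refl , S≡)  = inj₂ (C , refl , S≡)

  mirrored-neighbours : ∀ xs {a b : A} ys
    → (∃[ T ] b ∷ ys ≡ reverse (xs ∷ʳ a) ++ T) ⊎ (∃[ T ] xs ∷ʳ a ≡ T ++ reverse (b ∷ ys)) → a ≡ b
  mirrored-neighbours xs {a} ys (inj₁ (T , eq)) =
    sym (∷-injectiveˡ (trans eq (cong (_++ T) (reverse-++ xs (a ∷ [])))))
  mirrored-neighbours xs {a} {b} ys (inj₂ (T , eq)) = ∷ʳ-injectiveʳ xs (T ++ reverse ys) (begin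
    xs ∷ʳ a                      ≡⟨ eq ⟩
    T ++ reverse (b ∷ ys)        ≡⟨ cong (T ++_) (unfold-reverse b ys) ⟩
    T ++ (reverse ys ∷ʳ b)       ≡⟨ sym (++-assoc T (reverse ys) _) ⟩
    (T ++ reverse ys) ∷ʳ b       ∎)

wordOf-∷ʳ : ∀ es e → wordOf (es ∷ʳ e) ≡ wordOf es ++ block e
wordOf-∷ʳ es e = trans (concatMap-++ block es (e ∷ [])) (cong (wordOf es ++_) (++-identityʳ (block e)))

head-wordOf : ∀ es → head (wordOf es) ≢ just 1
head-wordOf []      ()
head-wordOf (_ ∷ _) ()

wordOf-injective : ∀ es fs → wordOf es ≡ wordOf fs → es ≡ fs
wordOf-injective []       []       _  = refl
wordOf-injective []       (_ ∷ _)  ()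
wordOf-injective (_ ∷ _)  []       ()
wordOf-injective (e ∷ es) (f ∷ fs) eq
  with refl , eq′ ← replicate-++-cancel e f (head-wordOf es) (head-wordOf fs) (∷-injectiveʳ (∷-injectiveʳ eq)) =
  cong (e ∷_) (wordOf-injective es fs eq′)

wordOf-ends-in-1 : ∀ e es → All (0 <_) (e ∷ es) → ∃[ w ] wordOf (e ∷ es) ≡ w ∷ʳ 1
wordOf-ends-in-1 (suc e) [] _ =
  2 ∷ 2 ∷ ones e , cong (λ t → 2 ∷ 2 ∷ t) (trans (++-identityʳ (ones (suc e))) (replicate-∷ʳ e 1))
wordOf-ends-in-1 e (f ∷ es) (_ ∷ pos) with w , eq ← wordOf-ends-in-1 f es pos =
  block e ++ w , trans (cong (block e ++_) eq) (sym (++-assoc (block e) w (1 ∷ [])))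

wordOf-not-palindrome : ∀ e es → All (0 <_) (e ∷ es) → ¬ IsPalindrome (wordOf (e ∷ es))
wordOf-not-palindrome e es pos pal with w , eq ← wordOf-ends-in-1 e es pos
  with () ← palindrome-head≡last _ w pal eq

-- 22 1^{e_1} 22 ⋯ 1^{e_n} 22; unlike wordOf es, its reversal has the same shape.
framed : List ℕ → Word
framed es = wordOf es ++ 2 ∷ 2 ∷ []

framed-∷ : ∀ e es → framed (e ∷ es) ≡ 2 ∷ 2 ∷ (ones e ++ framed es)
framed-∷ e es = cong (λ t → 2 ∷ 2 ∷ t) (++-assoc (ones e) (wordOf es) (2 ∷ 2 ∷ []))

reverse-framed : ∀ es → reverse (framed es) ≡ framed (reverse es)
reverse-framed []       = refl
reverse-framed (e ∷ es) = begin
  reverse (framed (e ∷ es))                         ≡⟨ cong reverse (framed-∷ e es) ⟩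
  reverse (block e ++ framed es)                    ≡⟨ reverse-++ (block e) (framed es) ⟩
  reverse (framed es) ++ reverse (block e)          ≡⟨ cong₂ _++_ (reverse-framed es) reverse-block ⟩
  framed (reverse es) ++ ones e ++ 2 ∷ 2 ∷ []       ≡⟨ ++-assoc (wordOf (reverse es)) (2 ∷ 2 ∷ []) _ ⟩
  wordOf (reverse es) ++ block e ++ 2 ∷ 2 ∷ []      ≡⟨ sym (++-assoc (wordOf (reverse es)) (block e) _) ⟩
  (wordOf (reverse es) ++ block e) ++ 2 ∷ 2 ∷ []    ≡⟨ cong (_++ 2 ∷ 2 ∷ []) (sym (wordOf-∷ʳ (reverse es) e)) ⟩
  framed (reverse es ∷ʳ e)                          ≡⟨ cong framed (sym (unfold-reverse e es)) ⟩
  framed (reverse (e ∷ es))                         ∎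
  where
  reverse-block : reverse (block e) ≡ ones e ++ 2 ∷ 2 ∷ []
  reverse-block = trans (reverse-++ (2 ∷ 2 ∷ []) (ones e)) (cong (_++ 2 ∷ 2 ∷ []) (reverse-replicate e 1))

palindrome-framed : ∀ es → IsPalindrome (framed es) → IsPalindrome es
palindrome-framed es pal =
  wordOf-injective _ _ (++-cancelʳ (2 ∷ 2 ∷ []) _ _ (trans (sym (reverse-framed es)) pal))

cut-before-ones : ∀ es u v → wordOf es ≡ u ++ 2 ∷ 1 ∷ v
  → ∃[ P ] ∃[ e ] ∃[ Q ] (es ≡ P ++ e ∷ Q × u ∷ʳ 2 ≡ framed P × 1 ∷ v ≡ ones e ++ wordOf Q)
cut-before-ones []       []      _ ()
cut-before-ones []       (_ ∷ _) _ ()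
cut-before-ones (e ∷ es) []      _ ()
cut-before-ones (e ∷ es) (_ ∷ []) v eq with refl ← ∷-injectiveˡ eq =
  [] , e , es , refl , refl , sym (∷-injectiveʳ (∷-injectiveʳ eq))
cut-before-ones (e ∷ es) (_ ∷ _ ∷ u) v eq
  with refl ← ∷-injectiveˡ eq | refl ← ∷-injectiveˡ (∷-injectiveʳ eq)
  with u′ , refl , eq′ ← replicate-++-prefix e (λ ()) (∷-injectiveʳ (∷-injectiveʳ eq))
  with P , f , Q , refl , u′2≡ , v≡ ← cut-before-ones es u′ v eq′ =
  e ∷ P , f , Q , refl , framed-u , v≡
  where
  framed-u : (2 ∷ 2 ∷ ones e ++ u′) ∷ʳ 2 ≡ framed (e ∷ P)
  framed-u = begin
    2 ∷ 2 ∷ (ones e ++ u′) ∷ʳ 2        ≡⟨ cong (λ t → 2 ∷ 2 ∷ t) (++-assoc (ones e) u′ (2 ∷ [])) ⟩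
    2 ∷ 2 ∷ ones e ++ u′ ∷ʳ 2          ≡⟨ cong (λ t → 2 ∷ 2 ∷ ones e ++ t) u′2≡ ⟩
    2 ∷ 2 ∷ ones e ++ framed P         ≡⟨ sym (framed-∷ e P) ⟩
    framed (e ∷ P)                     ∎

exponents-semisymmetric : ∀ es → All (0 <_) es → IsSemisymmetric (wordOf es) → IsSemisymmetric es
exponents-semisymmetric []       _   _ = [] , [] , refl , refl , refl
exponents-semisymmetric (e ∷ es) pos ([] , v , refl , _ , pv) = ⊥-elim (wordOf-not-palindrome e es pos pv)
exponents-semisymmetric (e ∷ es) pos (_ ∷ u , [] , eq , pu , _) =
  ⊥-elim (wordOf-not-palindrome e es pos (subst IsPalindrome (sym (trans eq (++-identityʳ _))) pu))
exponents-semisymmetric (e ∷ es) pos (_ ∷ u , y ∷ v , eq , pu , pv)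
  with refl ← ∷-injectiveˡ eq
  with u′ , u≡ ← palindrome-∷ʳ u pu
  with w , ends-1 ← wordOf-ends-in-1 e es pos
  with refl ← palindrome-head≡last v _ pv (proj₂ (∷ʳ-suffix (2 ∷ u) v w (trans (sym eq) ends-1)))
  with P , f , Q , es≡ , u≡P , v≡Q ← cut-before-ones (e ∷ es) u′ v
         (trans eq (trans (cong (_++ 1 ∷ v) u≡) (++-assoc u′ (2 ∷ []) (1 ∷ v)))) =
  P , f ∷ Q , es≡ ,
  palindrome-framed P (subst IsPalindrome (trans u≡ u≡P) pu) ,
  palindrome-framed (f ∷ Q) (palindrome-wrap (2 ∷ 2 ∷ []) (subst IsPalindrome v≡Q pv))

semisymmetric-mirror : ∀ {c} xs ys → c ∉ xs → c ∉ ys → IsSemisymmetric (xs ++ c ∷ ys)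
  → (∃[ T ] ys ≡ reverse xs ++ T) ⊎ (∃[ T ] xs ≡ T ++ reverse ys)
semisymmetric-mirror xs ys c∉xs c∉ys (P , S , eq , palP , palS) with ++-∷-≡-++ xs ys P S eq
... | inj₁ (B , refl , refl) = inj₁ (S , cong (_++ S) (palindrome-centre xs B c∉xs (c∉ys ∘ ∈-++⁺ˡ) palP))
... | inj₂ (C , refl , refl) = inj₂ (P , cong (P ++_) (begin
  C                    ≡⟨ sym (reverse-involutive C) ⟩
  reverse (reverse C)  ≡⟨ cong reverse (sym (palindrome-centre C ys (c∉xs ∘ ∈-++⁺ʳ P) c∉ys palS)) ⟩
  reverse ys           ∎))

<-all⇒∉ : ∀ {m} {xs : List ℕ} → All (m <_) xs → m ∉ xs
<-all⇒∉ m<xs = All¬⇒¬Any (All.map <⇒≢ m<xs)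

lemma4p2 : (k : ℕ) → .{{_ : NonZero k}} → (L : List ℕ) → (a b : ℕ) → (R : List ℕ)
    → All (λ s → 2 * k ≤ s) L → 2 * k ≤ a → 2 * k ≤ b → All (λ s → 2 * k ≤ s) R
    → a ≢ b
    → ¬ IsSemisymmetric (wordOf (L ++ a ∷ (2 * k ∸ 1) ∷ b ∷ R))
lemma4p2 k L a b R L≥ a≥ b≥ R≥ a≢b semi =
  a≢b (mirrored-neighbours L R (semisymmetric-mirror (L ∷ʳ a) (b ∷ R) c∉La c∉bR exponents))
  where
  c = 2 * k ∸ 1

  1<2k : 1 < 2 * k
  1<2k = *-monoʳ-≤ 2 (>-nonZero⁻¹ k)

  c<_ : ∀ {s} → 2 * k ≤ s → c < s
  c< 2k≤s = <-≤-trans (∸-monoʳ-< z<s (<⇒≤ 1<2k)) 2k≤s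

  0<c : 0 < c
  0<c = m<n⇒0<n∸m 1<2k

  positive : ∀ {s} → 2 * k ≤ s → 0 < s
  positive 2k≤s = <-trans 0<c (c< 2k≤s)

  c∉La : c ∉ L ∷ʳ a
  c∉La = <-all⇒∉ (++⁺ (All.map c<_ L≥) (c< a≥ ∷ []))

  c∉bR : c ∉ b ∷ R
  c∉bR = <-all⇒∉ (c< b≥ ∷ All.map c<_ R≥)

  exponents : IsSemisymmetric ((L ∷ʳ a) ++ c ∷ b ∷ R)
  exponents = subst IsSemisymmetric (sym (++-assoc L (a ∷ []) (c ∷ b ∷ R)))
    (exponents-semisymmetric _
      (++⁺ (All.map positive L≥) (positive a≥ ∷ 0<c ∷ positive b≥ ∷ All.map positive R≥))
      semi)
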